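{- Let $\pi\in S_4\setminus\{2143,2413,3142,3412\}$ and let $p=(\pi,R)$ with $R=(\{0,4\}\times[4])\cup([4]\times\{0,4\})$ (exactly the boundary boxes shaded). Then \[ \lim_{n\to\infty}\frac{s_n^+(p)}{n!}=0. \]
   Context: For $n\ge1$, $S_n$ is the set of permutations of $\{1,\dots,n\}$ in one-line notation $\tau=\tau_1\cdots\tau_n$. For an integer $k\ge0$ write $[k]=\{0,1,\dots,k\}$. A mesh pattern of length $k$ is a pair $(\pi,R)$ with $\pi\in S_k$ and $R\subseteq[k]\times[k]$; the elements $(x,y)\in R$ are the shaded boxes (box $(x,y)$ is the unit square with south-west corner $(x,y)$ in the plot of the points $(i,\pi_i)$). An occurrence of $(\pi,R)$ in $\tau\in S_n$ is a choice of positions $i_1<\dots<i_k$ such that $\tau_{i_a}<\tau_{i_b}$ iff $\pi_a<\pi_b$ for all $a,b$, and such that for every $(x,y)\in R$ there is no index $m$ with $i_x<m<i_{x+1}$ and $v_y<\tau_m<v_{y+1}$, where $i_0=0$, $i_{k+1}=n+1$, $v_0=0$, $v_{k+1}=n+1$, and for $1\le y\le k$, $v_y$ is the $y$-th smallest of the values $\tau_{i_1},\dots,\tau_{i_k}$. A permutation contains a mesh pattern if it has at least one occurrence of it, and $s_n^+(p)$ denotes the number of permutations in $S_n$ containing $p$. -}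

module Defs where

open import Data.Bool using (Bool; true; false; _∧_; _∨_; not)
open import Data.Nat using (ℕ; zero; suc; _+_; _<ᵇ_; _≡ᵇ_; _!)
open import Data.Nat.Properties using (_!≢0)
open import Data.List using (List; []; _∷_; _++_; [_]; length; map; filter; concatMap; upTo; applyUpTo; foldr)
open import Data.Bool.ListAction using (all; any)
open import Data.Product using (_×_; _,_)
open import Data.Integer using (+_)
open import Data.Rational using (ℚ; _/_)
open import Relation.Nullary.Decidable using (does)
open import Data.Bool.Properties using () renaming (_≟_ to _≟B_)
open import Relation.Binary.PropositionalEquality using (_≡_)

-- Permutations of {1,…,n} in one-line notation, as lists of naturals.

inserts : ℕ → List ℕ → List (List ℕ)
inserts x []       = (x ∷ []) ∷ []
inserts x (y ∷ ys) = (x ∷ y ∷ ys) ∷ map (y ∷_) (inserts x ys)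

perms : ℕ → List (List ℕ)
perms zero    = [] ∷ []
perms (suc n) = concatMap (inserts (suc n)) (perms n)

-- 0-indexed lookup with default 0
at : List ℕ → ℕ → ℕ
at []       _       = 0
at (x ∷ xs) zero    = x
at (x ∷ xs) (suc i) = at xs i

-- 1-indexed lookup: τ i = τ_i
_!!_ : List ℕ → ℕ → ℕ
xs !! zero  = 0
xs !! suc i = at xs i

choose : ℕ → List ℕ → List (List ℕ)
choose zero    _        = [] ∷ []
choose (suc k) []       = []
choose (suc k) (x ∷ xs) = map (x ∷_) (choose k xs) ++ choose (suc k) xs

oneTo : ℕ → List ℕ
oneTo n = applyUpTo suc n

zeroTo : ℕ → List ℕ
zeroTo n = upTo n

insert : ℕ → List ℕ → List ℕ
insert x []       = x ∷ []
insert x (y ∷ ys) with x <ᵇ y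
... | true  = x ∷ y ∷ ys
... | false = y ∷ insert x ys

sort : List ℕ → List ℕ
sort []       = []
sort (x ∷ xs) = insert x (sort xs)

_==_ : Bool → Bool → Bool
a == b = does (a ≟B b)

-- Mesh patterns (π , R): π a permutation of {1..k} in one-line notation,
-- R a list of shaded boxes (x , y) with 0 ≤ x,y ≤ k.

record MeshPattern : Set where
  constructor mesh
  field
    pat    : List ℕ
    shaded : List (ℕ × ℕ)
open MeshPattern public

-- Is the increasing position list `is` (= i₁ < … < i_k, 1-indexed)
-- an occurrence of the mesh pattern p in τ?
isOccurrence : List ℕ → MeshPattern → List ℕ → Bool
isOccurrence τ p is = orderIso ∧ all boxEmpty (shaded p)
  where
  π = pat p
  k = length π
  n = length τ
  vs = map (τ !!_) is
  orderIso : Bool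
  orderIso = all (λ a → all (λ b →
               ((vs !! a) <ᵇ (vs !! b)) == ((π !! a) <ᵇ (π !! b)))
               (oneTo k)) (oneTo k)
  I' : List ℕ
  I' = 0 ∷ is ++ [ suc n ]
  -- V' y = v_y (y-th smallest value) with v_0 = 0, v_{k+1} = n+1
  V' : List ℕ
  V' = 0 ∷ sort vs ++ [ suc n ]
  boxEmpty : ℕ × ℕ → Bool
  boxEmpty (x , y) = not (any (λ m →
      (at I' x <ᵇ m) ∧ (m <ᵇ at I' (suc x)) ∧
      (at V' y <ᵇ (τ !! m)) ∧ ((τ !! m) <ᵇ at V' (suc y)))
      (oneTo n))

contains : List ℕ → MeshPattern → Bool
contains τ p = any (isOccurrence τ p) (choose (length (pat p)) (oneTo (length τ)))

sPlus : MeshPattern → ℕ → ℕ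
sPlus p n = length (filter (λ τ → contains τ p ≟B true) (perms n))

ratio : MeshPattern → ℕ → ℚ
ratio p n = (+ sPlus p n) / (n !) where instance _ = _!≢0 n

boundary : ℕ → List (ℕ × ℕ)
boundary k = filter (λ b → isBoundary b ≟B true) allBoxes
  where
  allBoxes = concatMap (λ x → map (x ,_) (zeroTo (suc k))) (zeroTo (suc k))
  isBoundary : ℕ × ℕ → Bool
  isBoundary (x , y) = (x ≡ᵇ 0) ∨ (x ≡ᵇ k) ∨ (y ≡ᵇ 0) ∨ (y ≡ᵇ k)

-- In an occurrence of a pattern whose boundary boxes are all shaded, every point of τ outside
-- the occurrence lies in an interior box.  Hence the occurrence starts at position 1, ends at
-- position n, and uses the values 1 and n, so the order isomorphism carries an extreme first or
-- last entry of π to an extreme first or last entry of τ.  The permutations of length 4 excluded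
-- in the statement are exactly those whose first and last entries both lie in {2, 3}.  At most
-- (n-1)! permutations of length n have a prescribed first (or last) entry, so s⁺ₙ(p) ≤ 4 (n-1)!
-- and s⁺ₙ(p) / n! ≤ 4 / n.
module Submission where

open import Defs
open import Data.Nat using (ℕ; _≤_)
open import Data.List using (List; _∷_; [])
open import Data.List.Membership.Propositional using (_∈_; _∉_)
open import Data.Product using (∃; _,_)
open import Data.Rational using (ℚ; 0ℚ; _<_)

open import Algebra.Properties.CommutativeSemigroup using (interchange)
open import Data.Bool using (Bool; true; false; _∨_; _∧_; not; T)
open import Data.Bool.ListAction using (all; any)
open import Data.Bool.Properties using (T-≡; T-∨; T-∧; T-not-≡) renaming (_≟_ to _≟B_)
open import Data.Empty using (⊥; ⊥-elim)
import Data.Integer as ℤ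
import Data.Integer.Properties as ℤ
open import Data.Integer.GCD using (gcd)
open import Data.List using (upTo; [_]; _++_; length; map; filter; concatMap)
open import Data.List.Membership.Propositional using (find; lose)
open import Data.List.Membership.Propositional.Properties
  using (∈-length; ∈-++⁻; ∈-map⁺; ∈-map⁻; ∈-concatMap⁺; ∈-concatMap⁻; ∈-applyUpTo⁺; ∈-applyUpTo⁻; ∈-filter⁺; ∈-upTo⁺)
open import Data.List.Properties using (≡-dec; length-++; length-map; length-applyUpTo; applyUpTo-∷ʳ)
open import Data.List.Relation.Binary.Permutation.Propositional using (_↭_; prep; swap; ↭-refl; ↭-trans; ↭-sym; ↭⇒↭ₛ)
open import Data.List.Relation.Binary.Permutation.Propositional.Properties using (↭-length; ∈-resp-↭; ∷↭∷ʳ)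
import Data.List.Relation.Binary.Permutation.Setoid.Properties as SetoidPermutation
open import Data.List.Relation.Unary.All using (All; []; _∷_)
import Data.List.Relation.Unary.All as All
open import Data.List.Relation.Unary.All.Properties using (all⁺)
open import Data.List.Relation.Unary.AllPairs using (AllPairs; []; _∷_)
import Data.List.Relation.Unary.AllPairs.Properties as AllPairs
open import Data.List.Relation.Unary.Any using (here; there)
open import Data.List.Relation.Unary.Any.Properties using (any⁺; any⁻)
open import Data.List.Relation.Unary.Unique.Propositional using (Unique)
import Data.List.Relation.Unary.Unique.Propositional.Properties as Unique
import Data.Nat as ℕ
open import Data.Nat using (NonZero; suc; zero; _+_; _*_; _!; z≤n; s≤s; s<s; _≟_; _≡ᵇ_; _<ᵇ_)
open import Data.Nat.Properties
open import Data.Nat.Solver using (module +-*-Solver)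
open +-*-Solver using (solve; _:+_; _:*_; _:=_; con)
open import Data.List.Membership.DecPropositional _≟_ using (_∈?_)
open import Data.List.Membership.DecPropositional (≡-dec _≟_) using () renaming (_∈?_ to _∈ₗ?_)
open import Data.Product using (_×_; proj₁; proj₂)
open import Data.Rational using (mkℚ; _/_; ↥_; ↧_; *<*)
open import Data.Rational.Properties using (↥-/; ↧-/)
open import Data.Sum using (_⊎_; inj₁; inj₂)
open import Function using (_∘_)
open import Function.Bundles using (module Equivalence)
open Equivalence using (to; from)
open import Relation.Binary.Definitions using (tri<; tri≈; tri>)
open import Relation.Binary.PropositionalEquality
  using (_≡_; _≢_; refl; cong; cong₂; sym; trans; subst; subst₂; setoid; module ≡-Reasoning)
open import Relation.Nullary using (Dec; does; yes; no)
open import Relation.Nullary.Decidable using (dec-true; dec-false)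

private
  variable
    A B : Set

indicator : Bool → ℕ
indicator true  = 1
indicator false = 0

count : (A → Bool) → List A → ℕ
count p []       = 0
count p (x ∷ xs) = indicator (p x) + count p xs

count-cong : ∀ {p q : A → Bool} xs → (∀ {x} → x ∈ xs → p x ≡ q x) → count p xs ≡ count q xs
count-cong []       _   = refl
count-cong (x ∷ xs) p≗q = cong₂ _+_ (cong indicator (p≗q (here refl))) (count-cong xs (p≗q ∘ there))

count≤length : ∀ (p : A → Bool) xs → count p xs ≤ length xs
count≤length p []       = z≤n
count≤length p (x ∷ xs) with p x
... | true  = s≤s (count≤length p xs)
... | false = m≤n⇒m≤1+n (count≤length p xs)

count-++ : ∀ (p : A → Bool) xs ys → count p (xs ++ ys) ≡ count p xs + count p ys
count-++ p []       ys = refl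
count-++ p (x ∷ xs) ys = trans (cong (indicator (p x) +_) (count-++ p xs ys)) (sym (+-assoc (indicator (p x)) _ _))

count-map : ∀ (p : B → Bool) (f : A → B) xs → count p (map f xs) ≡ count (p ∘ f) xs
count-map p f []       = refl
count-map p f (x ∷ xs) = cong (indicator (p (f x)) +_) (count-map p f xs)

count-const : ∀ b (xs : List A) → count (λ _ → b) xs ≡ length xs * indicator b
count-const b []       = refl
count-const b (x ∷ xs) = cong (indicator b +_) (count-const b xs)

count-∨ : ∀ (p q : A → Bool) xs → count (λ x → p x ∨ q x) xs ≤ count p xs + count q xs
count-∨ p q []       = z≤n
count-∨ p q (x ∷ xs) = begin
  indicator (p x ∨ q x) + count (λ x → p x ∨ q x) xs
    ≤⟨ +-mono-≤ (indicator-∨ (p x) (q x)) (count-∨ p q xs) ⟩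
  (indicator (p x) + indicator (q x)) + (count p xs + count q xs)
    ≡⟨ interchange +-commutativeSemigroup (indicator (p x)) _ _ _ ⟩
  count p (x ∷ xs) + count q (x ∷ xs) ∎
  where
  open ≤-Reasoning
  indicator-∨ : ∀ a b → indicator (a ∨ b) ≤ indicator a + indicator b
  indicator-∨ true  b = s≤s z≤n
  indicator-∨ false b = ≤-refl

count-mono : ∀ {p q : A → Bool} xs → (∀ {x} → x ∈ xs → p x ≡ true → q x ≡ true) →
             count p xs ≤ count q xs
count-mono []       p⇒q = z≤n
count-mono {p = p} {q} (x ∷ xs) p⇒q with p x in px
... | false = ≤-trans (count-mono xs (p⇒q ∘ there)) (m≤n+m _ (indicator (q x)))
... | true rewrite p⇒q (here refl) px = s≤s (count-mono xs (p⇒q ∘ there))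

count-concatMap : ∀ (p : B → Bool) (q : A → Bool) (f : A → List B) k xs →
                  (∀ {x} → x ∈ xs → count p (f x) ≤ k * indicator (q x)) →
                  count p (concatMap f xs) ≤ k * count q xs
count-concatMap p q f k []       _     = z≤n
count-concatMap p q f k (x ∷ xs) bound = begin
  count p (f x ++ concatMap f xs)          ≡⟨ count-++ p (f x) (concatMap f xs) ⟩
  count p (f x) + count p (concatMap f xs) ≤⟨ +-mono-≤ (bound (here refl)) (count-concatMap p q f k xs (bound ∘ there)) ⟩
  k * indicator (q x) + k * count q xs     ≡⟨ *-distribˡ-+ k (indicator (q x)) _ ⟨
  k * count q (x ∷ xs)                     ∎
  where open ≤-Reasoning

length-filter≡count : ∀ (p : A → Bool) xs → length (filter (λ x → p x ≟B true) xs) ≡ count p xs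
length-filter≡count p []       = refl
length-filter≡count p (x ∷ xs) with p x
... | true  = cong suc (length-filter≡count p xs)
... | false = length-filter≡count p xs

length-concatMap : ∀ (f : A → List B) k xs → (∀ {x} → x ∈ xs → length (f x) ≡ k) →
                   length (concatMap f xs) ≡ k * length xs
length-concatMap f k []       _    = sym (*-zeroʳ k)
length-concatMap f k (x ∷ xs) lens = begin
  length (f x ++ concatMap f xs)          ≡⟨ length-++ (f x) ⟩
  length (f x) + length (concatMap f xs)  ≡⟨ cong₂ _+_ (lens (here refl)) (length-concatMap f k xs (lens ∘ there)) ⟩
  k + k * length xs                       ≡⟨ *-suc k (length xs) ⟨
  k * length (x ∷ xs)                     ∎
  where open ≡-Reasoning

at-∈ : ∀ xs {j} → j ℕ.< length xs → at xs j ∈ xs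
at-∈ (x ∷ xs) {zero}  _         = here refl
at-∈ (x ∷ xs) {suc j} (s≤s j<) = there (at-∈ xs j<)

∈⇒at : ∀ {xs z} → z ∈ xs → ∃ λ j → j ℕ.< length xs × at xs j ≡ z
∈⇒at (here refl) = 0 , s≤s z≤n , refl
∈⇒at (there z∈) with ∈⇒at z∈
... | j , j< , eq = suc j , s≤s j< , eq

at-injective : ∀ {xs} → Unique xs → ∀ {i j} → i ℕ.< length xs → j ℕ.< length xs → at xs i ≡ at xs j → i ≡ j
at-injective {x ∷ xs} _            {zero}  {zero}  _        _        _  = refl
at-injective {x ∷ xs} (x∉ ∷ _)     {zero}  {suc j} _        (s≤s j<) eq = ⊥-elim (All.lookup x∉ (at-∈ xs j<) eq)
at-injective {x ∷ xs} (x∉ ∷ _)     {suc i} {zero}  (s≤s i<) _        eq = ⊥-elim (All.lookup x∉ (at-∈ xs i<) (sym eq))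
at-injective {x ∷ xs} (_ ∷ unique) {suc i} {suc j} (s≤s i<) (s≤s j<) eq = cong suc (at-injective unique i< j< eq)

at-map : ∀ (f : ℕ → ℕ) xs {j} → j ℕ.< length xs → at (map f xs) j ≡ f (at xs j)
at-map f (x ∷ xs) {zero}  _        = refl
at-map f (x ∷ xs) {suc j} (s≤s j<) = at-map f xs j<

!!-∈ : ∀ xs {i} → i ∈ oneTo (length xs) → xs !! i ∈ xs
!!-∈ xs i∈ with ∈-applyUpTo⁻ suc i∈
... | _ , j< , refl = at-∈ xs j<

∈⇒!! : ∀ {xs z} → z ∈ xs → ∃ λ i → i ∈ oneTo (length xs) × xs !! i ≡ z
∈⇒!! z∈ with ∈⇒at z∈
... | j , j< , eq = suc j , ∈-applyUpTo⁺ suc j< , eq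

!!-injective : ∀ {xs} → Unique xs → ∀ {i j} → i ∈ oneTo (length xs) → j ∈ oneTo (length xs) → xs !! i ≡ xs !! j → i ≡ j
!!-injective unique i∈ j∈ eq with ∈-applyUpTo⁻ suc i∈ | ∈-applyUpTo⁻ suc j∈
... | _ , i< , refl | _ , j< , refl = cong suc (at-injective unique i< j< eq)

!!-map : ∀ (f : ℕ → ℕ) xs {i} → i ∈ oneTo (length xs) → map f xs !! i ≡ f (xs !! i)
!!-map f xs i∈ with ∈-applyUpTo⁻ suc i∈
... | _ , j< , refl = at-map f xs j<

∈-oneTo⁺ : ∀ {n z} → 1 ≤ z → z ≤ n → z ∈ oneTo n
∈-oneTo⁺ {z = suc z} _ 1+z≤n = ∈-applyUpTo⁺ suc 1+z≤n

∈-oneTo⁻ : ∀ {n z} → z ∈ oneTo n → 1 ≤ z × z ≤ n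
∈-oneTo⁻ z∈ with ∈-applyUpTo⁻ suc z∈
... | _ , i<n , refl = s≤s z≤n , i<n

-- final (x ∷ y ∷ ys) reduces to final (y ∷ ys); several proofs below rely on this.
first final : List ℕ → ℕ
first τ = τ !! 1
final τ = τ !! length τ

final-∈ : ∀ y ys → final (y ∷ ys) ∈ y ∷ ys
final-∈ y []       = here refl
final-∈ y (z ∷ zs) = there (final-∈ z zs)

first-≡-min : ∀ {v xs} → AllPairs ℕ._<_ xs → v ∈ xs → All (v ≤_) xs → first xs ≡ v
first-≡-min _          (here refl) _         = refl
first-≡-min (x<xs ∷ _) (there v∈)  (v≤x ∷ _) = ⊥-elim (<⇒≱ (All.lookup x<xs v∈) v≤x)

final-≡-max : ∀ {v xs} → AllPairs ℕ._<_ xs → v ∈ xs → All (_≤ v) xs → final xs ≡ v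
final-≡-max {xs = x ∷ []}     _            (here refl) _             = refl
final-≡-max {xs = x ∷ y ∷ ys} (x<ys ∷ _)   (here refl) (_ ∷ y≤x ∷ _) = ⊥-elim (<⇒≱ (All.lookup x<ys (here refl)) y≤x)
final-≡-max {xs = x ∷ y ∷ ys} (_ ∷ sorted) (there v∈)  (_ ∷ ≤v)      = final-≡-max sorted v∈ ≤v

Unique-oneTo : ∀ n → Unique (oneTo n)
Unique-oneTo n = Unique.applyUpTo⁺₁ suc n (λ i<j _ → <⇒≢ (s<s i<j))

Unique-resp-↭ : ∀ {xs ys : List ℕ} → xs ↭ ys → Unique xs → Unique ys
Unique-resp-↭ xs↭ys = SetoidPermutation.Unique-resp-↭ (setoid ℕ) (↭⇒↭ₛ xs↭ys)

insert-↭ : ∀ x xs → insert x xs ↭ x ∷ xs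
insert-↭ x []       = ↭-refl
insert-↭ x (y ∷ ys) with x <ᵇ y
... | true  = ↭-refl
... | false = ↭-trans (prep y (insert-↭ x ys)) (swap y x ↭-refl)

sort-↭ : ∀ xs → sort xs ↭ xs
sort-↭ []       = ↭-refl
sort-↭ (x ∷ xs) = ↭-trans (insert-↭ x (sort xs)) (prep x (sort-↭ xs))

length-inserts : ∀ x σ → length (inserts x σ) ≡ suc (length σ)
length-inserts x []       = refl
length-inserts x (y ∷ ys) = cong suc (trans (length-map (y ∷_) (inserts x ys)) (length-inserts x ys))

inserts-↭ : ∀ x σ {τ} → τ ∈ inserts x σ → τ ↭ x ∷ σ
inserts-↭ x []       (here refl) = ↭-refl
inserts-↭ x (y ∷ ys) (here refl) = ↭-refl
inserts-↭ x (y ∷ ys) (there τ∈) with ∈-map⁻ (y ∷_) τ∈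
... | τ′ , τ′∈ , refl = ↭-trans (prep y (inserts-↭ x ys τ′∈)) (swap y x ↭-refl)

∈-perms⁻ : ∀ n {τ} → τ ∈ perms (suc n) → ∃ λ σ → σ ∈ perms n × τ ∈ inserts (suc n) σ
∈-perms⁻ n τ∈ = find (∈-concatMap⁻ (inserts (suc n)) {xs = perms n} τ∈)

perms-↭ : ∀ n {τ} → τ ∈ perms n → τ ↭ oneTo n
perms-↭ zero    (here refl) = ↭-refl
perms-↭ (suc n) τ∈ with ∈-perms⁻ n τ∈
... | σ , σ∈ , τ∈ins = ↭-trans (inserts-↭ (suc n) σ τ∈ins)
  (↭-trans (prep (suc n) (perms-↭ n σ∈))
  (subst (suc n ∷ oneTo n ↭_) (applyUpTo-∷ʳ suc n) (∷↭∷ʳ (suc n) (oneTo n))))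

length-perms : ∀ n → length (perms n) ≡ n !
length-perms zero    = refl
length-perms (suc n) = begin
  length (concatMap (inserts (suc n)) (perms n)) ≡⟨ length-concatMap (inserts (suc n)) (suc n) (perms n) length-inserts-perm ⟩
  suc n * length (perms n)                       ≡⟨ cong (suc n *_) (length-perms n) ⟩
  suc n * n !                                    ∎
  where
  open ≡-Reasoning
  length-inserts-perm : ∀ {σ} → σ ∈ perms n → length (inserts (suc n) σ) ≡ suc n
  length-inserts-perm {σ} σ∈ = trans (length-inserts (suc n) σ) (cong suc (trans (↭-length (perms-↭ n σ∈)) (length-applyUpTo suc n)))

module _ {n τ} (τ↭ : τ ↭ oneTo n) where

  perm-length : length τ ≡ n
  perm-length = trans (↭-length τ↭) (length-applyUpTo suc n)

  perm-entry : ∀ {z} → z ∈ τ → 1 ≤ z × z ≤ n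
  perm-entry z∈ = ∈-oneTo⁻ (∈-resp-↭ τ↭ z∈)

  perm-complete : ∀ {z} → 1 ≤ z → z ≤ n → z ∈ τ
  perm-complete 1≤z z≤bound = ∈-resp-↭ (↭-sym τ↭) (∈-oneTo⁺ 1≤z z≤bound)

  perm-unique : Unique τ
  perm-unique = Unique-resp-↭ (↭-sym τ↭) (Unique-oneTo n)

-- Permutations with a prescribed first or last entry

-- perms (suc n) inserts suc n in every position of every σ ∈ perms n.  For such a statistic,
-- f = c is inherited from σ when c is not the inserted value, and arises at most once when it is.
record InsertionStatistic (f : List ℕ → ℕ) : Set where
  field
    count-inserts-≢ : ∀ {x c} σ → x ≢ c →
      count (λ τ → f τ ≡ᵇ c) (inserts x σ) ≤ length σ * indicator (f σ ≡ᵇ c)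
    count-inserts-new : ∀ {x} σ → x ∉ σ → count (λ τ → f τ ≡ᵇ x) (inserts x σ) ≤ 1

count-statistic-perms : ∀ {f} → InsertionStatistic f → ∀ c m →
                        count (λ τ → f τ ≡ᵇ c) (perms (suc m)) ≤ m !
count-statistic-perms {f} S c zero    = count≤length (λ τ → f τ ≡ᵇ c) (perms 1)
count-statistic-perms {f} S c (suc m) with c ≟ suc (suc m)
... | yes refl = begin
  count (λ τ → f τ ≡ᵇ c) (perms (suc (suc m)))
    ≤⟨ count-concatMap _ (λ _ → true) (inserts c) 1 (perms (suc m)) (λ σ∈ → count-inserts-new _ (new-∉ σ∈)) ⟩
  1 * count (λ _ → true) (perms (suc m))
    ≡⟨ *-identityˡ _ ⟩
  count (λ _ → true) (perms (suc m))
    ≤⟨ count≤length _ (perms (suc m)) ⟩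
  length (perms (suc m))
    ≡⟨ length-perms (suc m) ⟩
  suc m ! ∎
  where
  open ≤-Reasoning
  open InsertionStatistic S
  new-∉ : ∀ {σ} → σ ∈ perms (suc m) → c ∉ σ
  new-∉ σ∈ c∈ = 1+n≰n (proj₂ (perm-entry (perms-↭ (suc m) σ∈) c∈))
... | no c≢ = begin
  count (λ τ → f τ ≡ᵇ c) (perms (suc (suc m)))
    ≤⟨ count-concatMap _ (λ σ → f σ ≡ᵇ c) (inserts (suc (suc m))) (suc m) (perms (suc m)) insert-bound ⟩
  suc m * count (λ τ → f τ ≡ᵇ c) (perms (suc m))
    ≤⟨ *-monoʳ-≤ (suc m) (count-statistic-perms S c m) ⟩
  suc m * m ! ∎
  where
  open ≤-Reasoning
  open InsertionStatistic S
  insert-bound : ∀ {σ} → σ ∈ perms (suc m) →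
    count (λ τ → f τ ≡ᵇ c) (inserts (suc (suc m)) σ) ≤ suc m * indicator (f σ ≡ᵇ c)
  insert-bound {σ} σ∈ = subst (λ l → count (λ τ → f τ ≡ᵇ c) (inserts (suc (suc m)) σ) ≤ l * indicator (f σ ≡ᵇ c))
    (perm-length (perms-↭ (suc m) σ∈)) (count-inserts-≢ σ (c≢ ∘ sym))

first-statistic : InsertionStatistic first
first-statistic = record { count-inserts-≢ = count-≢ ; count-inserts-new = count-new }
  where
  open ≡-Reasoning
  count-first-map-∷ : ∀ c y L → count (λ τ → first τ ≡ᵇ c) (map (y ∷_) L) ≡ length L * indicator (y ≡ᵇ c)
  count-first-map-∷ c y L = trans (count-map (λ τ → first τ ≡ᵇ c) (y ∷_) L) (count-const (y ≡ᵇ c) L)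

  count-≢ : ∀ {x c} σ → x ≢ c → count (λ τ → first τ ≡ᵇ c) (inserts x σ) ≤ length σ * indicator (first σ ≡ᵇ c)
  count-≢ {x} {c} []       x≢c rewrite dec-false (x ≟ c) x≢c = z≤n
  count-≢ {x} {c} (y ∷ ys) x≢c rewrite dec-false (x ≟ c) x≢c = ≤-reflexive (begin
    count (λ τ → first τ ≡ᵇ c) (map (y ∷_) (inserts x ys)) ≡⟨ count-first-map-∷ c y (inserts x ys) ⟩
    length (inserts x ys) * indicator (y ≡ᵇ c)            ≡⟨ cong (_* indicator (y ≡ᵇ c)) (length-inserts x ys) ⟩
    suc (length ys) * indicator (y ≡ᵇ c)                  ∎)

  count-new : ∀ {x} σ → x ∉ σ → count (λ τ → first τ ≡ᵇ x) (inserts x σ) ≤ 1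
  count-new {x} []       _   rewrite dec-true (x ≟ x) refl = ≤-refl
  count-new {x} (y ∷ ys) x∉σ rewrite dec-true (x ≟ x) refl = ≤-reflexive (cong suc (begin
    count (λ τ → first τ ≡ᵇ x) (map (y ∷_) (inserts x ys)) ≡⟨ count-first-map-∷ x y (inserts x ys) ⟩
    length (inserts x ys) * indicator (y ≡ᵇ x)            ≡⟨ cong (λ b → length (inserts x ys) * indicator b) (dec-false (y ≟ x) (x∉σ ∘ here ∘ sym)) ⟩
    length (inserts x ys) * 0                             ≡⟨ *-zeroʳ (length (inserts x ys)) ⟩
    0                                                     ∎))

final-statistic : InsertionStatistic final
final-statistic = record { count-inserts-≢ = count-≢ ; count-inserts-new = count-new }
  where
  final-∷-inserts : ∀ {x σ τ} y → τ ∈ inserts x σ → final (y ∷ τ) ≡ final τ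
  final-∷-inserts {σ = []}     y (here refl) = refl
  final-∷-inserts {σ = z ∷ zs} y (here refl) = refl
  final-∷-inserts {σ = z ∷ zs} y (there τ∈) with ∈-map⁻ (z ∷_) τ∈
  ... | _ , _ , refl = refl

  count-final-map-∷ : ∀ c x y ys → count (λ τ → final τ ≡ᵇ c) (map (y ∷_) (inserts x ys)) ≡ count (λ τ → final τ ≡ᵇ c) (inserts x ys)
  count-final-map-∷ c x y ys = trans (count-map (λ τ → final τ ≡ᵇ c) (y ∷_) (inserts x ys))
    (count-cong (inserts x ys) (λ τ∈ → cong (_≡ᵇ c) (final-∷-inserts y τ∈)))

  count-≢ : ∀ {x c} σ → x ≢ c → count (λ τ → final τ ≡ᵇ c) (inserts x σ) ≤ length σ * indicator (final σ ≡ᵇ c)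
  count-≢ {x} {c} []           x≢c rewrite dec-false (x ≟ c) x≢c = z≤n
  count-≢ {x} {c} (y ∷ [])     x≢c rewrite dec-false (x ≟ c) x≢c = ≤-refl
  count-≢ {x} {c} (y ∷ z ∷ zs) x≢c = +-monoʳ-≤ (indicator (final (z ∷ zs) ≡ᵇ c))
    (≤-trans (≤-reflexive (count-final-map-∷ c x y (z ∷ zs))) (count-≢ (z ∷ zs) x≢c))

  count-new : ∀ {x} σ → x ∉ σ → count (λ τ → final τ ≡ᵇ x) (inserts x σ) ≤ 1
  count-new {x} []       _   rewrite dec-true (x ≟ x) refl = ≤-refl
  count-new {x} (y ∷ ys) x∉σ
    rewrite count-final-map-∷ x x y ys | dec-false (final (y ∷ ys) ≟ x) (λ eq → x∉σ (subst (_∈ y ∷ ys) eq (final-∈ y ys)))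
    = count-new ys (x∉σ ∘ there)

isExtreme : ℕ → ℕ → Bool
isExtreme n v = (v ≡ᵇ 1) ∨ (v ≡ᵇ n)

endsExtreme : ℕ → List ℕ → Bool
endsExtreme n τ = isExtreme n (first τ) ∨ isExtreme n (final τ)

count-endsExtreme-perms : ∀ m → count (endsExtreme (suc m)) (perms (suc m)) ≤ 4 * m !
count-endsExtreme-perms m = begin
  count (endsExtreme n) (perms n)
    ≤⟨ count-∨ (isExtreme n ∘ first) (isExtreme n ∘ final) (perms n) ⟩
  count (isExtreme n ∘ first) (perms n) + count (isExtreme n ∘ final) (perms n)
    ≤⟨ +-mono-≤ (count-isExtreme first-statistic) (count-isExtreme final-statistic) ⟩
  (m ! + m !) + (m ! + m !)
    ≡⟨ solve 1 (λ x → (x :+ x) :+ (x :+ x) := con 4 :* x) refl (m !) ⟩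
  4 * m ! ∎
  where
  open ≤-Reasoning
  n = suc m
  count-isExtreme : ∀ {f} → InsertionStatistic f → count (λ τ → isExtreme n (f τ)) (perms n) ≤ m ! + m !
  count-isExtreme {f} S = ≤-trans (count-∨ (λ τ → f τ ≡ᵇ 1) (λ τ → f τ ≡ᵇ n) (perms n))
    (+-mono-≤ (count-statistic-perms S 1 m) (count-statistic-perms S n m))

-- Occurrences of a pattern with shaded boundary

choose-⊆ : ∀ k xs {ys} → ys ∈ choose k xs → ∀ {z} → z ∈ ys → z ∈ xs
choose-⊆ zero    xs       (here refl) ()
choose-⊆ (suc k) (x ∷ xs) ys∈ z∈ with ∈-++⁻ (map (x ∷_) (choose k xs)) ys∈
... | inj₂ ys∈′ = there (choose-⊆ (suc k) xs ys∈′ z∈)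
... | inj₁ ys∈′ with ∈-map⁻ (x ∷_) ys∈′
...   | _ , ys′∈ , refl with z∈
...     | here z≡x   = here z≡x
...     | there z∈′  = there (choose-⊆ k xs ys′∈ z∈′)

length-choose : ∀ k xs {ys} → ys ∈ choose k xs → length ys ≡ k
length-choose zero    xs       (here refl) = refl
length-choose (suc k) (x ∷ xs) ys∈ with ∈-++⁻ (map (x ∷_) (choose k xs)) ys∈
... | inj₂ ys∈′ = length-choose (suc k) xs ys∈′
... | inj₁ ys∈′ with ∈-map⁻ (x ∷_) ys∈′
...   | _ , ys′∈ , refl = cong suc (length-choose k xs ys′∈)

AllPairs-choose : ∀ {R : ℕ → ℕ → Set} k xs {ys} → AllPairs R xs → ys ∈ choose k xs → AllPairs R ys
AllPairs-choose zero    xs       _              (here refl) = []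
AllPairs-choose (suc k) (x ∷ xs) (Rx ∷ Rxs) ys∈ with ∈-++⁻ (map (x ∷_) (choose k xs)) ys∈
... | inj₂ ys∈′ = AllPairs-choose (suc k) xs Rxs ys∈′
... | inj₁ ys∈′ with ∈-map⁻ (x ∷_) ys∈′
...   | _ , ys′∈ , refl = All.tabulate (All.lookup Rx ∘ choose-⊆ k xs ys′∈) ∷ AllPairs-choose k xs Rxs ys′∈

InGap : List ℕ → ℕ → ℕ → Set
InGap L x v = at L x ℕ.< v × v ℕ.< at L (suc x)

-- The grid lines 0 = i₀ < i₁ < … < i_k < i_{k+1} = n + 1 of an occurrence, and likewise
-- for the values, as used by isOccurrence.
frame : ℕ → List ℕ → List ℕ
frame n xs = 0 ∷ xs ++ [ suc n ]

∉⇒InGap : ∀ {a b v} xs → a ℕ.< v → v ℕ.< b → v ∉ xs → ∃ λ y → y ≤ length xs × InGap (a ∷ xs ++ [ b ]) y v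
∉⇒InGap []       a<v v<b _   = 0 , z≤n , a<v , v<b
∉⇒InGap {v = v} (c ∷ cs) a<v v<b v∉ with <-cmp v c
... | tri< v<c _   _   = 0 , z≤n , a<v , v<c
... | tri≈ _   v≡c _   = ⊥-elim (v∉ (here v≡c))
... | tri> _   _   c<v with ∉⇒InGap cs c<v v<b (v∉ ∘ there)
...   | y , y≤ , in-gap = suc y , s≤s y≤ , in-gap

at-∷-++-∈ : ∀ a b xs y → y ℕ.< length xs → at (a ∷ xs ++ [ b ]) (suc y) ∈ xs
at-∷-++-∈ a b (x ∷ xs) zero    _          = here refl
at-∷-++-∈ a b (x ∷ xs) (suc y) (s≤s y<∣xs∣) = there (at-∷-++-∈ x b xs y y<∣xs∣)

-- The bounds on y matter: `at` returns 0 past the end of a list.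
module _ {n xs} (xs⊆ : ∀ {z} → z ∈ xs → 1 ≤ z × z ≤ n) where

  InGap-frame-1 : ∀ {y} → y ≤ length xs → InGap (frame n xs) y 1 → y ≡ 0
  InGap-frame-1 {zero}  _       _          = refl
  InGap-frame-1 {suc y} 1+y≤∣xs∣ (below , _) =
    ⊥-elim (<⇒≱ below (proj₁ (xs⊆ (at-∷-++-∈ 0 (suc n) xs y 1+y≤∣xs∣))))

  InGap-frame-n : ∀ {y} → y ≤ length xs → InGap (frame n xs) y n → y ≡ length xs
  InGap-frame-n {y} y≤∣xs∣ (_ , above) with m≤n⇒m<n∨m≡n y≤∣xs∣
  ... | inj₂ y≡∣xs∣ = y≡∣xs∣
  ... | inj₁ y<∣xs∣ = ⊥-elim (<⇒≱ above (proj₂ (xs⊆ (at-∷-++-∈ 0 (suc n) xs y y<∣xs∣))))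

∈-boundary : ∀ k {x y} → x ≤ k → y ≤ k → x ≡ 0 ⊎ x ≡ k ⊎ y ≡ 0 ⊎ y ≡ k → (x , y) ∈ boundary k
∈-boundary k {x} {y} x≤k y≤k on-edge = ∈-filter⁺ (λ b → isOnEdge b ≟B true) box (T-≡ .to (edge on-edge))
  where
  isOnEdge : ℕ × ℕ → Bool
  isOnEdge (x , y) = (x ≡ᵇ 0) ∨ (x ≡ᵇ k) ∨ (y ≡ᵇ 0) ∨ (y ≡ᵇ k)
  box : (x , y) ∈ concatMap (λ x → map (x ,_) (upTo (suc k))) (upTo (suc k))
  box = ∈-concatMap⁺ (λ x → map (x ,_) (upTo (suc k))) (lose (∈-upTo⁺ (s≤s x≤k)) (∈-map⁺ (x ,_) (∈-upTo⁺ (s≤s y≤k))))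
  edge : x ≡ 0 ⊎ x ≡ k ⊎ y ≡ 0 ⊎ y ≡ k → T (isOnEdge (x , y))
  edge (inj₁ refl)               = _
  edge (inj₂ (inj₁ refl))        = T-∨ {x ≡ᵇ 0} .from (inj₂ (T-∨ {x ≡ᵇ x} .from (inj₁ (≡⇒≡ᵇ x x refl))))
  edge (inj₂ (inj₂ (inj₁ refl))) = T-∨ {x ≡ᵇ 0} .from (inj₂ (T-∨ {x ≡ᵇ k} .from (inj₂ _)))
  edge (inj₂ (inj₂ (inj₂ refl))) = T-∨ {x ≡ᵇ 0} .from (inj₂ (T-∨ {x ≡ᵇ k} .from (inj₂
                                     (T-∨ {y ≡ᵇ 0} .from (inj₂ (≡⇒≡ᵇ y y refl))))))

values : List ℕ → List ℕ → List ℕ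
values τ is = map (τ !!_) is

-- The two conjuncts of isOccurrence, copied out of its where block:
-- isOccurrence τ (mesh π R) is reduces to orderIsoᵇ τ π is ∧ all (boxEmptyᵇ τ is) R.
orderIsoᵇ : List ℕ → List ℕ → List ℕ → Bool
orderIsoᵇ τ π is = all (λ a → all (λ b →
  ((values τ is !! a) <ᵇ (values τ is !! b)) == ((π !! a) <ᵇ (π !! b))) (oneTo (length π))) (oneTo (length π))

boxEmptyᵇ : List ℕ → List ℕ → ℕ × ℕ → Bool
boxEmptyᵇ τ is (x , y) = not (any (λ m →
  (at I x <ᵇ m) ∧ (m <ᵇ at I (suc x)) ∧ (at V y <ᵇ (τ !! m)) ∧ ((τ !! m) <ᵇ at V (suc y))) (oneTo (length τ)))
  where
  I = frame (length τ) is
  V = frame (length τ) (sort (values τ is))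

T-==⇒≡ : ∀ {x y} → T (x == y) → x ≡ y
T-==⇒≡ {true}  {true}  _ = refl
T-==⇒≡ {false} {false} _ = refl

module _ {τ π R is} (occ : T (isOccurrence τ (mesh π R) is)) where

  occurrence-order : ∀ {a b} → a ∈ oneTo (length π) → b ∈ oneTo (length π) →
                     values τ is !! a ℕ.< values τ is !! b → π !! a ℕ.< π !! b
  occurrence-order {a} {b} a∈ b∈ v<v = <ᵇ⇒< _ _ (subst T (T-==⇒≡ same-order) (<⇒<ᵇ v<v))
    where
    same-order : T (((values τ is !! a) <ᵇ (values τ is !! b)) == ((π !! a) <ᵇ (π !! b)))
    same-order = All.lookup (all⁺ _ _ (All.lookup (all⁺ _ _ (proj₁ (T-∧ {orderIsoᵇ τ π is} .to occ))) a∈)) b∈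

  occurrence-box : ∀ {x y m} → (x , y) ∈ R → m ∈ oneTo (length τ) →
                   InGap (frame (length τ) is) x m → InGap (frame (length τ) (sort (values τ is))) y (τ !! m) → ⊥
  occurrence-box {x} {y} xy∈ m∈ (x< , <x) (y< , <y) = subst T (T-not-≡ .to box-empty)
    (any⁺ _ (lose m∈ (T-∧ .from (<⇒<ᵇ x< , T-∧ .from (<⇒<ᵇ <x , T-∧ .from (<⇒<ᵇ y< , <⇒<ᵇ <y))))))
    where
    box-empty : T (boxEmptyᵇ τ is (x , y))
    box-empty = All.lookup (all⁺ (boxEmptyᵇ τ is) R (proj₂ (T-∧ {orderIsoᵇ τ π is} .to occ))) xy∈

module BoundaryOccurrence {τ π is : List ℕ}
  (τ↭ : τ ↭ oneTo (length τ)) (π↭ : π ↭ oneTo (length π)) (nonempty : 1 ≤ length τ)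
  (is∈ : is ∈ choose (length π) (oneTo (length τ)))
  (occ : T (isOccurrence τ (mesh π (boundary (length π))) is)) where

  private
    n k : ℕ
    n = length τ
    k = length π
    vs : List ℕ
    vs = values τ is

  position-range : ∀ {i} → i ∈ is → 1 ≤ i × i ≤ n
  position-range = ∈-oneTo⁻ ∘ choose-⊆ k (oneTo n) is∈

  value-range : ∀ {v} → v ∈ vs → 1 ≤ v × v ≤ n
  value-range v∈ with ∈-map⁻ (τ !!_) v∈
  ... | i , i∈ , refl = perm-entry τ↭ (!!-∈ τ (∈-oneTo⁺ (proj₁ (position-range i∈)) (proj₂ (position-range i∈))))

  length-is : length is ≡ k
  length-is = length-choose k (oneTo n) is∈

  length-values : length vs ≡ k
  length-values = trans (length-map (τ !!_) is) length-is

  length-sorted : length (sort vs) ≡ k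
  length-sorted = trans (↭-length (sort-↭ vs)) length-values

  sorted-range : ∀ {v} → v ∈ sort vs → 1 ≤ v × v ≤ n
  sorted-range = value-range ∘ ∈-resp-↭ (sort-↭ vs)

  outside-value-∉ : ∀ {m} → m ∈ oneTo n → m ∉ is → τ !! m ∉ sort vs
  outside-value-∉ m∈ m∉ v∈ with ∈-map⁻ (τ !!_) (∈-resp-↭ (sort-↭ vs) v∈)
  ... | i , i∈ , τm≡τi = m∉ (subst (_∈ is) (sym (!!-injective (perm-unique τ↭) m∈ i∈τ τm≡τi)) i∈)
    where
    i∈τ : i ∈ oneTo n
    i∈τ = ∈-oneTo⁺ (proj₁ (position-range i∈)) (proj₂ (position-range i∈))

  -- A point off the occurrence lies in some box (x , y); all boundary boxes are empty,
  -- so 0 < x < k and 0 < y < k.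
  outside-interior : ∀ {m} → m ∈ oneTo n → m ∉ is → m ≢ 1 × m ≢ n × τ !! m ≢ 1 × τ !! m ≢ n
  outside-interior {m} m∈ m∉ with ∈-oneTo⁻ m∈ | ∈-oneTo⁻ (∈-resp-↭ τ↭ (!!-∈ τ m∈))
  ... | 1≤m , m≤n | 1≤τm , τm≤n
    with ∉⇒InGap is 1≤m (s≤s m≤n) m∉ | ∉⇒InGap (sort vs) 1≤τm (s≤s τm≤n) (outside-value-∉ m∈ m∉)
  ... | x , x≤ , column | y , y≤ , row =
      (λ { refl → on-edge (inj₁ (InGap-frame-1 position-range x≤ column)) })
    , (λ { refl → on-edge (inj₂ (inj₁ (trans (InGap-frame-n position-range x≤ column) length-is))) })
    , (λ τm≡1 → on-edge (inj₂ (inj₂ (inj₁ (InGap-frame-1 sorted-range y≤ (subst (InGap (frame n (sort vs)) y) τm≡1 row))))))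
    , (λ τm≡n → on-edge (inj₂ (inj₂ (inj₂
        (trans (InGap-frame-n sorted-range y≤ (subst (InGap (frame n (sort vs)) y) τm≡n row)) length-sorted)))))
    where
    on-edge : x ≡ 0 ⊎ x ≡ k ⊎ y ≡ 0 ⊎ y ≡ k → ⊥
    on-edge e = occurrence-box {τ} {π} {boundary k} {is} occ
      (∈-boundary k (subst (x ≤_) length-is x≤) (subst (y ≤_) length-sorted y≤) e) m∈ column row

  1∈is : 1 ∈ is
  1∈is with 1 ∈? is
  ... | yes 1∈ = 1∈
  ... | no  1∉ = ⊥-elim (proj₁ (outside-interior (∈-oneTo⁺ ≤-refl nonempty) 1∉) refl)

  n∈is : n ∈ is
  n∈is with n ∈? is
  ... | yes n∈ = n∈
  ... | no  n∉ = ⊥-elim (proj₁ (proj₂ (outside-interior (∈-oneTo⁺ nonempty ≤-refl) n∉)) refl)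

  value-used : ∀ {v} → 1 ≤ v → v ≤ n → (∀ {m} → m ∈ oneTo n → m ∉ is → τ !! m ≢ v) → v ∈ vs
  value-used 1≤v v≤n interior with ∈⇒!! (perm-complete τ↭ 1≤v v≤n)
  ... | m , m∈ , τm≡v with m ∈? is
  ...   | yes m∈is = subst (_∈ vs) τm≡v (∈-map⁺ (τ !!_) m∈is)
  ...   | no  m∉is = ⊥-elim (interior m∈ m∉is τm≡v)

  1∈vs : 1 ∈ vs
  1∈vs = value-used ≤-refl nonempty (λ m∈ m∉ → proj₁ (proj₂ (proj₂ (outside-interior m∈ m∉))))

  n∈vs : n ∈ vs
  n∈vs = value-used nonempty ≤-refl (λ m∈ m∉ → proj₂ (proj₂ (proj₂ (outside-interior m∈ m∉))))

  increasing : AllPairs ℕ._<_ is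
  increasing = AllPairs-choose k (oneTo n) (AllPairs.applyUpTo⁺₁ suc n (λ i<j _ → s<s i<j)) is∈

  1∈oneTo-k : 1 ∈ oneTo k
  1∈oneTo-k = ∈-oneTo⁺ ≤-refl (subst (1 ≤_) length-is (∈-length 1∈is))

  k∈oneTo-k : k ∈ oneTo k
  k∈oneTo-k = ∈-oneTo⁺ (subst (1 ≤_) length-is (∈-length 1∈is)) ≤-refl

  first-value : vs !! 1 ≡ first τ
  first-value = begin
    vs !! 1        ≡⟨ !!-map (τ !!_) is (subst (λ l → 1 ∈ oneTo l) (sym length-is) 1∈oneTo-k) ⟩
    τ !! first is  ≡⟨ cong (τ !!_) (first-≡-min increasing 1∈is (All.tabulate (proj₁ ∘ position-range))) ⟩
    τ !! 1         ∎
    where open ≡-Reasoning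

  final-value : vs !! k ≡ final τ
  final-value = begin
    vs !! k        ≡⟨ !!-map (τ !!_) is (subst (λ l → k ∈ oneTo l) (sym length-is) k∈oneTo-k) ⟩
    τ !! (is !! k) ≡⟨ cong (λ l → τ !! (is !! l)) (sym length-is) ⟩
    τ !! final is  ≡⟨ cong (τ !!_) (final-≡-max increasing n∈is (All.tabulate (proj₂ ∘ position-range))) ⟩
    τ !! n         ∎
    where open ≡-Reasoning

  private
    order : ∀ {a b} → a ∈ oneTo k → b ∈ oneTo k → vs !! a ℕ.< vs !! b → π !! a ℕ.< π !! b
    order = occurrence-order {τ} {π} {boundary k} {is} occ

    pattern-range : ∀ {a} → a ∈ oneTo k → 1 ≤ π !! a × π !! a ≤ k
    pattern-range = perm-entry π↭ ∘ !!-∈ π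

    value-at : ∀ {a} → a ∈ oneTo k → 1 ≤ vs !! a × vs !! a ≤ n
    value-at a∈ = value-range (!!-∈ vs (subst (λ l → _ ∈ oneTo l) (sym length-values) a∈))

    index-of : ∀ {v} → v ∈ vs → ∃ λ b → b ∈ oneTo k × vs !! b ≡ v
    index-of v∈ with ∈⇒!! v∈
    ... | b , b∈ , vb≡v = b , subst (λ l → b ∈ oneTo l) length-values b∈ , vb≡v

  min-value : ∀ {a} → a ∈ oneTo k → π !! a ≡ 1 → vs !! a ≡ 1
  min-value {a} a∈ πa≡1 with index-of 1∈vs
  ... | b , b∈ , vb≡1 = ≤-antisym
    (≮⇒≥ λ 1<va → <⇒≱ (subst (π !! b ℕ.<_) πa≡1 (order b∈ a∈ (subst (ℕ._< vs !! a) (sym vb≡1) 1<va)))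
                       (proj₁ (pattern-range b∈)))
    (proj₁ (value-at a∈))

  max-value : ∀ {a} → a ∈ oneTo k → π !! a ≡ k → vs !! a ≡ n
  max-value {a} a∈ πa≡k with index-of n∈vs
  ... | b , b∈ , vb≡n = ≤-antisym
    (proj₂ (value-at a∈))
    (≮⇒≥ λ va<n → <⇒≱ (subst (ℕ._< π !! b) πa≡k (order a∈ b∈ (subst (vs !! a ℕ.<_) (sym vb≡n) va<n)))
                       (proj₂ (pattern-range b∈)))

  isExtreme-transfer : ∀ {a} → a ∈ oneTo k → T (isExtreme k (π !! a)) → T (isExtreme n (vs !! a))
  isExtreme-transfer a∈ extreme with T-∨ .to extreme
  ... | inj₁ πa≡1 = T-∨ .from (inj₁ (≡⇒≡ᵇ _ _ (min-value a∈ (≡ᵇ⇒≡ _ _ πa≡1))))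
  ... | inj₂ πa≡k = T-∨ .from (inj₂ (≡⇒≡ᵇ _ _ (max-value a∈ (≡ᵇ⇒≡ _ _ πa≡k))))

  endsExtreme-transfer : T (endsExtreme k π) → T (endsExtreme n τ)
  endsExtreme-transfer ends with T-∨ .to ends
  ... | inj₁ e = T-∨ .from (inj₁ (subst (T ∘ isExtreme n) first-value (isExtreme-transfer 1∈oneTo-k e)))
  ... | inj₂ e = T-∨ {isExtreme n (first τ)} .from (inj₂ (subst (T ∘ isExtreme n) final-value (isExtreme-transfer k∈oneTo-k e)))

contains-boundary⇒endsExtreme : ∀ {k m π τ} → π ∈ perms k → τ ∈ perms (suc m) →
  T (endsExtreme k π) → T (contains τ (mesh π (boundary k))) → T (endsExtreme (suc m) τ)
contains-boundary⇒endsExtreme {k} {m} {π} {τ} π∈ τ∈ ends τ-contains =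
  subst (λ l → T (endsExtreme l τ)) τ-length (at-occurrence (find (any⁻ _ _ occurs)))
  where
  π-length : length π ≡ k
  π-length = perm-length (perms-↭ k π∈)
  τ-length : length τ ≡ suc m
  τ-length = perm-length (perms-↭ (suc m) τ∈)
  occurs : T (contains τ (mesh π (boundary (length π))))
  occurs = subst (λ l → T (contains τ (mesh π (boundary l)))) (sym π-length) τ-contains
  at-occurrence : (∃ λ is → is ∈ choose (length π) (oneTo (length τ)) × T (isOccurrence τ (mesh π (boundary (length π))) is)) →
                  T (endsExtreme (length τ) τ)
  at-occurrence (is , is∈ , occ) = BoundaryOccurrence.endsExtreme-transfer
    (subst (λ l → τ ↭ oneTo l) (sym τ-length) (perms-↭ (suc m) τ∈))
    (subst (λ l → π ↭ oneTo l) (sym π-length) (perms-↭ k π∈))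
    (subst (1 ≤_) (sym τ-length) (s≤s z≤n)) is∈ occ
    (subst (λ l → T (endsExtreme l π)) (sym π-length) ends)

S₄-innerEnds : List (List ℕ)
S₄-innerEnds = (2 ∷ 1 ∷ 4 ∷ 3 ∷ []) ∷ (2 ∷ 4 ∷ 1 ∷ 3 ∷ []) ∷ (3 ∷ 1 ∷ 4 ∷ 2 ∷ []) ∷ (3 ∷ 4 ∷ 1 ∷ 2 ∷ []) ∷ []

S₄-endsExtreme : ∀ {π} → π ∈ perms 4 → π ∉ S₄-innerEnds → T (endsExtreme 4 π)
-- The `_` checks, by evaluation, every one of the 24 elements of perms 4.
S₄-endsExtreme {π} π∈ π∉ = inner-or-extreme (π ∈ₗ? S₄-innerEnds)
  (All.lookup (all⁺ (λ σ → does (σ ∈ₗ? S₄-innerEnds) ∨ endsExtreme 4 σ) (perms 4) _) π∈)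
  where
  inner-or-extreme : (inner? : Dec (π ∈ S₄-innerEnds)) → T (does inner? ∨ endsExtreme 4 π) → T (endsExtreme 4 π)
  inner-or-extreme (yes inner) _    = ⊥-elim (π∉ inner)
  inner-or-extreme (no  _)     ends = ends

-- ↥ and ↧ of (+ s) / d are s and d divided by g = gcd s d, so the cross inequality
-- for the normalised fraction is the given one divided by g.
fraction-< : ∀ s d .{{_ : NonZero d}} (ε : ℚ) → ℤ.+ s ℤ.* ↧ ε ℤ.< ↥ ε ℤ.* ℤ.+ d → (ℤ.+ s) / d < ε
fraction-< s d ε cross = *<* (ℤ.*-cancelʳ-<-nonNeg g (subst₂ ℤ._<_ (sym numerator) (sym denominator) cross))
  where
  open ≡-Reasoning
  r : ℚ
  r = (ℤ.+ s) / d
  g : ℤ.ℤ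
  g = gcd (ℤ.+ s) (ℤ.+ d)
  numerator : (↥ r ℤ.* ↧ ε) ℤ.* g ≡ ℤ.+ s ℤ.* ↧ ε
  numerator = begin
    (↥ r ℤ.* ↧ ε) ℤ.* g ≡⟨ ℤ.*-assoc (↥ r) (↧ ε) g ⟩
    ↥ r ℤ.* (↧ ε ℤ.* g) ≡⟨ cong (↥ r ℤ.*_) (ℤ.*-comm (↧ ε) g) ⟩
    ↥ r ℤ.* (g ℤ.* ↧ ε) ≡⟨ ℤ.*-assoc (↥ r) g (↧ ε) ⟨
    (↥ r ℤ.* g) ℤ.* ↧ ε ≡⟨ cong (ℤ._* ↧ ε) (↥-/ (ℤ.+ s) d) ⟩
    ℤ.+ s ℤ.* ↧ ε         ∎
  denominator : (↥ ε ℤ.* ↧ r) ℤ.* g ≡ ↥ ε ℤ.* ℤ.+ d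
  denominator = trans (ℤ.*-assoc (↥ ε) (↧ r) g) (cong (↥ ε ℤ.*_) (↧-/ (ℤ.+ s) d))

factorial-dominates : ∀ s C q p m → s ≤ C * m ! → C * q ≤ m → s * q ℕ.< suc p * suc m !
factorial-dominates s C q p m s≤ Cq≤m = begin-strict
  s * q           ≤⟨ *-monoˡ-≤ q s≤ ⟩
  (C * m !) * q   ≡⟨ solve 3 (λ c f q → (c :* f) :* q := (c :* q) :* f) refl C (m !) q ⟩
  (C * q) * m !   ≤⟨ *-monoˡ-≤ (m !) Cq≤m ⟩
  m * m !         <⟨ m<n+m (m * m !) (1≤n! m) ⟩
  suc m !         ≤⟨ m≤m+n (suc m !) (p * suc m !) ⟩
  suc p * suc m ! ∎
  where open ≤-Reasoning

-- For ε = (1 + a) / (1 + b) and n > C (1 + b): s⁺ₙ / n! ≤ C / n < 1 / (1 + b) ≤ ε.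
ratio-tendsto-0 : ∀ p C → (∀ m → sPlus p (suc m) ≤ C * m !) →
                  ∀ ε → 0ℚ < ε → ∃ λ N → ∀ n → N ≤ n → ratio p n < ε
ratio-tendsto-0 p C bound ε@(mkℚ (ℤ.+ suc a) b-1 _) _ = suc (C * suc b-1) , eventually
  where
  eventually : ∀ n → suc (C * suc b-1) ≤ n → ratio p n < ε
  eventually (suc m) (s≤s Cb≤m) = fraction-< (sPlus p (suc m)) (suc m !) {{suc m !≢0}} _
    (subst₂ ℤ._<_ (ℤ.pos-* (sPlus p (suc m)) (suc b-1)) (ℤ.pos-* (suc a) (suc m !))
      (ℤ.+<+ (factorial-dominates _ C (suc b-1) a m (bound m) Cb≤m)))
ratio-tendsto-0 p C bound (mkℚ (ℤ.+ 0)      _ _) (*<* (ℤ.+<+ ()))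
ratio-tendsto-0 p C bound (mkℚ ℤ.-[1+ _ ]   _ _) (*<* ())

theorem4p2 : (π : List ℕ) → π ∈ perms 4 →
    π ∉ (2 ∷ 1 ∷ 4 ∷ 3 ∷ []) ∷ (2 ∷ 4 ∷ 1 ∷ 3 ∷ []) ∷ (3 ∷ 1 ∷ 4 ∷ 2 ∷ []) ∷ (3 ∷ 4 ∷ 1 ∷ 2 ∷ []) ∷ [] →
    (ε : ℚ) → 0ℚ < ε →
    ∃ λ (N : ℕ) → (n : ℕ) → N ≤ n → ratio (mesh π (boundary 4)) n < ε
theorem4p2 π π∈ π∉ = ratio-tendsto-0 p 4 bound
  where
  p = mesh π (boundary 4)
  bound : ∀ m → sPlus p (suc m) ≤ 4 * m !
  bound m = begin
    sPlus p (suc m)                             ≡⟨ length-filter≡count (λ τ → contains τ p) (perms (suc m)) ⟩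
    count (λ τ → contains τ p) (perms (suc m))  ≤⟨ count-mono (perms (suc m)) ends-extreme ⟩
    count (endsExtreme (suc m)) (perms (suc m)) ≤⟨ count-endsExtreme-perms m ⟩
    4 * m !                                     ∎
    where
    open ≤-Reasoning
    ends-extreme : ∀ {τ} → τ ∈ perms (suc m) → contains τ p ≡ true → endsExtreme (suc m) τ ≡ true
    ends-extreme τ∈ c = T-≡ .to (contains-boundary⇒endsExtreme π∈ τ∈ (S₄-endsExtreme π∈ π∉) (T-≡ .from c))
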